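{- (i) There are no constants $a>0$ and $b$ such that $a\cdot\mu_d(G)+b\ge\mu_d(G-x)$ holds for every connected graph $G$ and every $x\in V(G)$ with $G-x$ connected. (ii) There are no constants $a>0$ and $b$ such that $a\cdot\mu_t(G)+b\ge\mu_t(G-x)$ holds for every connected graph $G$ and every $x\in V(G)$ with $G-x$ connected.
   Context: All graphs are finite, simple and connected; $G-x$ is the graph obtained by deleting $x$ and its incident edges. For a connected graph $G$ and $X\subseteq V(G)$, two vertices $u,v$ are $X$-visible if there is a shortest $u,v$-path $P$ in $G$ with $V(P)\cap X\subseteq\{u,v\}$. $X$ is a dual mutual-visibility set if all $u,v$ with $u,v\in X$ or $u,v\in V(G)\setminus X$ are $X$-visible; a total mutual-visibility set if all $u,v\in V(G)$ are $X$-visible. $\mu_d(G)$ and $\mu_t(G)$ denote the maximum cardinalities of such sets, respectively.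
   Formalization: The constants $a>0$ and $b$ are taken in the rationals. -}

module Defs where

open import Data.Nat using (ℕ; zero; suc; _≤_)
open import Data.Bool using (Bool; true; false)
open import Data.Fin using (Fin; punchIn)
open import Data.Fin.Subset using (Subset; _∈_; _∉_; ∣_∣)
open import Data.List using (List; []; _∷_)
open import Data.List.Relation.Unary.All using (All)
open import Data.Product using (Σ; ∃; _×_; _,_)
open import Data.Sum using (_⊎_)
open import Relation.Binary.PropositionalEquality using (_≡_)

record Graph (n : ℕ) : Set where
  field
    adj    : Fin n → Fin n → Bool
    sym    : ∀ i j → adj i j ≡ adj j i
    irrefl : ∀ i → adj i i ≡ false
open Graph public

module _ {n : ℕ} (G : Graph n) where

  data Walk : Fin n → Fin n → Set where
    stay : ∀ {u} → Walk u u
    step : ∀ {u w v} → adj G u w ≡ true → Walk w v → Walk u v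

  len : ∀ {u v} → Walk u v → ℕ
  len stay       = zero
  len (step _ p) = suc (len p)

  verts : ∀ {u v} → Walk u v → List (Fin n)
  verts {u} stay       = u ∷ []
  verts {u} (step _ p) = u ∷ verts p

  Connected : Set
  Connected = ∀ u v → Walk u v

  -- a shortest u,v-walk (necessarily a path): no u,v-walk is shorter
  IsShortest : ∀ {u v} → Walk u v → Set
  IsShortest {u} {v} p = ∀ (q : Walk u v) → len p ≤ len q

  Visible : Subset n → Fin n → Fin n → Set
  Visible X u v =
    Σ (Walk u v) λ p → IsShortest p ×
      All (λ w → w ∈ X → (w ≡ u) ⊎ (w ≡ v)) (verts p)

  DualMV : Subset n → Set
  DualMV X = ∀ u v → ((u ∈ X × v ∈ X) ⊎ (u ∉ X × v ∉ X)) → Visible X u v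

  TotalMV : Subset n → Set
  TotalMV X = ∀ u v → Visible X u v

  IsMaxCard : (Subset n → Set) → ℕ → Set
  IsMaxCard P k = (Σ (Subset n) λ X → P X × ∣ X ∣ ≡ k)
                × (∀ X → P X → ∣ X ∣ ≤ k)

  IsMuD : ℕ → Set
  IsMuD = IsMaxCard DualMV

  IsMuT : ℕ → Set
  IsMuT = IsMaxCard TotalMV

delete : ∀ {m} → Graph (suc m) → Fin (suc m) → Graph m
delete G x = record
  { adj    = λ i j → adj G (punchIn x i) (punchIn x j)
  ; sym    = λ i j → sym G (punchIn x i) (punchIn x j)
  ; irrefl = λ i → irrefl G (punchIn x i)
  }

-- Let θ be the theta graph made of n ≥ 2 internally disjoint paths x – aᵢ – bᵢ – cᵢ – y.
-- Deleting x leaves a spider whose n leaves aᵢ form a total mutual-visibility set, because a leaf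
-- is never an inner vertex of a shortest path; hence μ_t(θ − x) ≥ n and μ_d(θ − x) ≥ n.
-- In θ itself every vertex v is, for a suitable pair at distance 2 or 3, the unique second vertex
-- of all shortest paths between them; a short case analysis on which vertices of such pairs lie in a
-- dual mutual-visibility set X then shows that X is empty, so μ_d(θ) = μ_t(θ) = 0.  A bound
-- a · 0 + b ≥ n for every n is impossible.  As the theorem is a negation, the maxima μ(θ − x) may
-- be taken to exist classically.

module Submission where

open import Defs
open import Data.Nat using (ℕ; suc)
open import Data.Fin using (Fin)
open import Data.Product using (Σ; _×_)
open import Relation.Nullary using (¬_)

module Subsets where
  open import Data.Empty using (⊥-elim)
  open import Data.Fin using (zero; suc; _↑ˡ_)
  open import Data.Fin.Subset using (_∈_; ⊥; ⊤; ∣_∣)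
  open import Data.Fin.Subset.Properties using (∣⊥∣≡0; ∉⊥)
  open import Data.Nat using (zero; _+_)
  open import Data.Product as Product using (∃; _,_)
  open import Data.Vec using (_++_; here; there)
  open import Relation.Binary.PropositionalEquality using (_≡_; refl; cong)

  ∈⊤++⊥ : ∀ k {l} {u : Fin (k + l)} → u ∈ ⊤ {k} ++ ⊥ {l} → ∃ λ i → i ↑ˡ l ≡ u
  ∈⊤++⊥ zero    u∈         = ⊥-elim (∉⊥ u∈)
  ∈⊤++⊥ (suc k) here       = zero , refl
  ∈⊤++⊥ (suc k) (there u∈) = Product.map suc (cong suc) (∈⊤++⊥ k u∈)

  ∣⊤++⊥∣ : ∀ k l → ∣ ⊤ {k} ++ ⊥ {l} ∣ ≡ k
  ∣⊤++⊥∣ zero    l = ∣⊥∣≡0 l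
  ∣⊤++⊥∣ (suc k) l = cong suc (∣⊤++⊥∣ k l)

module Graphs where
  open import Data.Bool using (true)
  open import Data.Bool.Properties using () renaming (_≟_ to _≟ᵇ_)
  open import Data.Empty using (⊥-elim)
  open import Data.Fin using (zero; suc; punchIn)
  open import Data.Fin.Properties using (any?) renaming (_≟_ to _≟ᶠ_)
  open import Data.Fin.Subset using (_∈_; _∉_; ⊥; ∣_∣)
  open import Data.Fin.Subset.Properties using (∣⊥∣≡0; Empty-unique; ∣p∣≤n; ∉⊥)
  open import Data.List.Relation.Unary.All as All using (All; []; _∷_)
  open import Data.Nat using (zero; _+_; _≤_; _<_; z≤n; s≤s)
  open import Data.Nat.Properties
    using ( ≤-refl; ≤-reflexive; ≤-trans; ≤-pred; ≰⇒>; ≮⇒≥; <⇒≱; <-irrefl; n≤1+n; m≤m+n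
          ; +-suc; +-monoʳ-≤ )
  open import Data.Product using (∃; _,_)
  open import Data.Sum using (_⊎_; inj₁; inj₂)
  open import Function using (_∘_)
  open import Relation.Nullary using (Dec; yes; no)
  open import Relation.Nullary.Decidable using (_×-dec_)
  open import Relation.Nullary.Decidable.Core using (¬¬-excluded-middle)
  open import Relation.Binary.PropositionalEquality using (_≡_; _≢_; refl; trans; subst; cong)
    renaming (sym to ≡-sym)

  lift-walk : ∀ {m} {G : Graph (suc m)} {z u v} →
              Walk (delete G z) u v → Walk G (punchIn z u) (punchIn z v)
  lift-walk stay       = stay
  lift-walk (step e p) = step e (lift-walk p)

  module _ {n : ℕ} (G : Graph n) where

    _++ᵂ_ : ∀ {u v w} → Walk G u v → Walk G v w → Walk G u w
    stay     ++ᵂ q = q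
    step e p ++ᵂ q = step e (p ++ᵂ q)

    reverseᵂ : ∀ {u v} → Walk G u v → Walk G v u
    reverseᵂ stay               = stay
    reverseᵂ (step {u} {w} e p) = reverseᵂ p ++ᵂ step (trans (sym G w u) e) stay

    connected-via : (h : Fin n) → (∀ u → Walk G u h) → Connected G
    connected-via h to-h u v = to-h u ++ᵂ reverseᵂ (to-h v)

    adj-sym : ∀ {u w} → adj G u w ≡ true → adj G w u ≡ true
    adj-sym {u} {w} e = trans (sym G w u) e

    ¬loop : ∀ {u} → ¬ adj G u u ≡ true
    ¬loop {u} e with trans (≡-sym e) (irrefl G u)
    ... | ()

    All-verts-start : ∀ {P : Fin n → Set} {u v} (p : Walk G u v) → All P (verts G p) → P u
    All-verts-start stay       (Pu ∷ _) = Pu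
    All-verts-start (step _ _) (Pu ∷ _) = Pu

    Walk≤ : ℕ → Fin n → Fin n → Set
    Walk≤ k u v = Σ (Walk G u v) λ p → len G p ≤ k

    walk≤? : ∀ k u v → Dec (Walk≤ k u v)
    walk≤? k u v with u ≟ᶠ v
    ... | yes refl = yes (stay , z≤n)
    walk≤? zero    u v | no u≢v = no λ { (stay , _) → u≢v refl ; (step _ _ , ()) }
    walk≤? (suc k) u v | no u≢v with any? (λ w → (adj G u w ≟ᵇ true) ×-dec walk≤? k w v)
    ... | yes (w , e , p , p≤k) = yes (step e p , s≤s p≤k)
    ... | no ¬via = no λ { (stay , _) → u≢v refl
                         ; (step {w = w} e p , s≤s p≤k) → ¬via (w , e , p , p≤k) }

    ¬walk≤-zero : ∀ {u v} → u ≢ v → ¬ Walk≤ zero u v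
    ¬walk≤-zero u≢v (stay , _)      = u≢v refl
    ¬walk≤-zero u≢v (step _ _ , ())

    ¬walk≤-suc : ∀ {k u v} → u ≢ v → (∀ {w} → adj G u w ≡ true → ¬ Walk≤ k w v) →
                 ¬ Walk≤ (suc k) u v
    ¬walk≤-suc u≢v far (stay , _)           = u≢v refl
    ¬walk≤-suc u≢v far (step e p , s≤s p≤k) = far e (p , p≤k)

    shortest-within : ∀ k {u v} → Walk≤ k u v → Σ (Walk G u v) (IsShortest G)
    shortest-within zero    (p , p≤0) = p , λ _ → ≤-trans p≤0 z≤n
    shortest-within (suc k) {u} {v} (p , p≤) with walk≤? k u v
    ... | yes q≤k = shortest-within k q≤k
    ... | no ¬q≤k = p , λ q → ≤-trans p≤ (≰⇒> λ q≤k → ¬q≤k (q , q≤k))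

    shortest : ∀ {u v} → Walk G u v → Σ (Walk G u v) (IsShortest G)
    shortest p = shortest-within (len G p) (p , ≤-refl)

    -- The last two hypotheses say that every shortest u,v-walk leaves u through m.
    blocked-by : ∀ {X u v} m k → m ∈ X → m ≢ v → u ≢ v → Walk≤ (suc k) u v →
                 (∀ {w} → adj G u w ≡ true → w ≢ m → ¬ Walk≤ k w v) → ¬ Visible G X u v
    blocked-by m k m∈X m≢v u≢v _ _ (stay , _) = u≢v refl
    blocked-by m k m∈X m≢v u≢v (r , r≤) far (step {w = w} e p , p-shortest , clear) with w ≟ᶠ m
    ... | no w≢m = far e w≢m (p , ≤-pred (≤-trans (p-shortest r) r≤))
    ... | yes refl with All-verts-start p (All.tail clear) m∈X
    ...   | inj₁ refl = ¬loop e
    ...   | inj₂ m≡v  = m≢v m≡v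

    IsLeaf : Fin n → Set
    IsLeaf w = ∃ λ m → ∀ {z} → adj G w z ≡ true → z ≡ m

    leaf-ends-shortest : ∀ {u w v} (e : adj G u w ≡ true) (p : Walk G w v) →
                         IsShortest G (step e p) → IsLeaf w → w ≡ v
    leaf-ends-shortest e stay        _          _            = refl
    leaf-ends-shortest e (step e′ p) p-shortest (m , only-m)
      with trans (only-m (adj-sym e)) (≡-sym (only-m e′))
    ... | refl = ⊥-elim (<-irrefl refl (≤-trans (n≤1+n _) (p-shortest p)))

    leaves-on-shortest : ∀ {u v} (p : Walk G u v) → IsShortest G p →
                         All (λ z → IsLeaf z → (z ≡ u) ⊎ (z ≡ v)) (verts G p)
    leaves-on-shortest stay _ = (λ _ → inj₁ refl) ∷ []
    leaves-on-shortest {u} {v} (step {w = w} e p) p-shortest =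
      (λ _ → inj₁ refl) ∷ All.map inner (leaves-on-shortest p λ q → ≤-pred (p-shortest (step e q)))
      where
      inner : ∀ {z} → (IsLeaf z → (z ≡ w) ⊎ (z ≡ v)) → IsLeaf z → (z ≡ u) ⊎ (z ≡ v)
      inner end leaf with end leaf
      ... | inj₁ refl = inj₂ (leaf-ends-shortest e p p-shortest leaf)
      ... | inj₂ z≡v  = inj₂ z≡v

    leaves-totalMV : Connected G → ∀ X → (∀ {w} → w ∈ X → IsLeaf w) → TotalMV G X
    leaves-totalMV conn X leaves u v with shortest (conn u v)
    ... | p , p-shortest =
      p , p-shortest , All.map (λ end w∈X → end (leaves w∈X)) (leaves-on-shortest p p-shortest)

    ∅-totalMV : Connected G → TotalMV G ⊥
    ∅-totalMV conn = leaves-totalMV conn ⊥ (⊥-elim ∘ ∉⊥)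

    totalMV⇒dualMV : ∀ {X} → TotalMV G X → DualMV G X
    totalMV⇒dualMV tot u v _ = tot u v

    maxCard-zero : ∀ {P} → P ⊥ → (∀ X → P X → ∀ u → u ∉ X) → IsMaxCard G P 0
    maxCard-zero P⊥ never =
      (⊥ , P⊥ , ∣⊥∣≡0 n) ,
      λ X PX → ≤-reflexive (trans (cong ∣_∣ (Empty-unique λ (u , u∈X) → never X PX u u∈X))
                                  (∣⊥∣≡0 n))

    ¬¬-maxCard : ∀ {P} X → P X → ¬ ¬ ∃ (IsMaxCard G P)
    ¬¬-maxCard {P} X PX = climb n X PX (m≤m+n n ∣ X ∣)
      where
      maximal : ∀ X → P X → ¬ (∃ λ Y → P Y × ∣ X ∣ < ∣ Y ∣) → ∃ (IsMaxCard G P)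
      maximal X PX ¬larger = ∣ X ∣ , (X , PX , refl) , λ Y PY → ≮⇒≥ λ X<Y → ¬larger (Y , PY , X<Y)

      climb : ∀ fuel X → P X → n ≤ fuel + ∣ X ∣ → ¬ ¬ ∃ (IsMaxCard G P)
      grow  : ∀ fuel X → n ≤ fuel + ∣ X ∣ → ∀ Y → P Y → ∣ X ∣ < ∣ Y ∣ →
              ¬ ¬ ∃ (IsMaxCard G P)

      climb fuel X PX room ¬max = ¬¬-excluded-middle λ where
        (no ¬larger)         → ¬max (maximal X PX ¬larger)
        (yes (Y , PY , X<Y)) → grow fuel X room Y PY X<Y ¬max

      grow zero       X room Y _  X<Y _ = <⇒≱ X<Y (≤-trans (∣p∣≤n Y) room)
      grow (suc fuel) X room Y PY X<Y   =
        climb fuel Y PY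
          (≤-trans room (subst (_≤ fuel + ∣ Y ∣) (+-suc fuel ∣ X ∣) (+-monoʳ-≤ fuel X<Y)))

module Presentations where
  open Graphs
  open import Data.Bool using (true)
  open import Data.Fin.Subset using (Subset; _∈_)
  open import Data.Product using (_,_)
  open import Function using (_∘_)
  open import Function.Bundles using (_↔_; Inverse; mk⇔)
  open import Relation.Nullary using (Dec; yes; does)
  open import Relation.Nullary.Decidable using (dec-true; dec-false; does-⇔)
  open import Relation.Binary.PropositionalEquality using (_≡_; _≢_; cong; subst; subst₂; trans)
    renaming (sym to ≡-sym)

  does≡true⇒ : ∀ {A : Set} (a? : Dec A) → does a? ≡ true → A
  does≡true⇒ (yes a) _ = a

  module FromRelation {N : ℕ} {V : Set} (code : Fin N ↔ V) {_∼_ : V → V → Set}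
                      (_∼?_ : ∀ k l → Dec (k ∼ l)) (∼-sym : ∀ {k l} → k ∼ l → l ∼ k)
                      (∼-irrefl : ∀ {k} → ¬ k ∼ k)
                      where
    open Inverse code

    graph : Graph N
    graph = record
      { adj    = λ u w → does (to u ∼? to w)
      ; sym    = λ u w → does-⇔ (mk⇔ ∼-sym ∼-sym) (to u ∼? to w) (to w ∼? to u)
      ; irrefl = λ u → dec-false (to u ∼? to u) ∼-irrefl
      }

    adj⇒∼ : ∀ {u w} → adj graph u w ≡ true → to u ∼ to w
    adj⇒∼ {u} {w} = does≡true⇒ (to u ∼? to w)

    ∼⇒adj : ∀ {k l} → k ∼ l → adj graph (from k) (from l) ≡ true
    ∼⇒adj {k} {l} k∼l =
      dec-true (to (from k) ∼? to (from l))
               (subst₂ _∼_ (≡-sym (strictlyInverseˡ k)) (≡-sym (strictlyInverseˡ l)) k∼l)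

  module Presented {N : ℕ} (G : Graph N) {V : Set} (code : Fin N ↔ V) {_∼_ : V → V → Set}
                   (adj⇒∼ : ∀ {u w} → adj G u w ≡ true → Inverse.to code u ∼ Inverse.to code w)
                   (∼⇒adj : ∀ {k l} → k ∼ l → adj G (Inverse.from code k) (Inverse.from code l) ≡ true)
                   where
    open Inverse code public using () renaming (to to ⌞_⌟; from to ⌜_⌝)
    open Inverse code using (strictlyInverseˡ; strictlyInverseʳ)

    data Coded : Fin N → Set where
      coded : ∀ k → Coded ⌜ k ⌝

    view : ∀ u → Coded u
    view u = subst Coded (strictlyInverseʳ u) (coded ⌞ u ⌟)

    ⌜⌝-injective : ∀ {k l} → ⌜ k ⌝ ≡ ⌜ l ⌝ → k ≡ l
    ⌜⌝-injective {k} {l} eq =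
      trans (≡-sym (strictlyInverseˡ k)) (trans (cong ⌞_⌟ eq) (strictlyInverseˡ l))

    adj⇒∼ᶜ : ∀ {k l} → adj G ⌜ k ⌝ ⌜ l ⌝ ≡ true → k ∼ l
    adj⇒∼ᶜ {k} {l} e = subst₂ _∼_ (strictlyInverseˡ k) (strictlyInverseˡ l) (adj⇒∼ e)

    infixr 5 _◅_
    _◅_ : ∀ {k l v} → k ∼ l → Walk G ⌜ l ⌝ v → Walk G ⌜ k ⌝ v
    k∼l ◅ p = step (∼⇒adj k∼l) p

    -- Records rather than abbreviations: unification cannot see through ⌜_⌝, but it can
    -- recover k and l from the indices of a record type.
    record Farther (d : ℕ) (k l : V) : Set where
      constructor farther
      field ¬walk≤ : ¬ Walk≤ G d ⌜ k ⌝ ⌜ l ⌝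
    open Farther public

    record Visibleᶜ (X : Subset N) (k l : V) : Set where
      constructor visibleᶜ
      field visible : Visible G X ⌜ k ⌝ ⌜ l ⌝

    farther-zero : ∀ {k l} → k ≢ l → Farther 0 k l
    farther-zero k≢l = farther (¬walk≤-zero G (k≢l ∘ ⌜⌝-injective))

    farther-suc : ∀ {d k l} → k ≢ l → (∀ {k′} → k ∼ k′ → Farther d k′ l) → Farther (suc d) k l
    farther-suc {d} {k} {l} k≢l far =
      farther (¬walk≤-suc G (k≢l ∘ ⌜⌝-injective) λ {w} → via (view w))
      where
      via : ∀ {w} → Coded w → adj G ⌜ k ⌝ w ≡ true → ¬ Walk≤ G d w ⌜ l ⌝
      via (coded k′) e = ¬walk≤ (far (adj⇒∼ᶜ e))

    blocked-byᶜ : ∀ {X u v} m d → ⌜ m ⌝ ∈ X → m ≢ v → u ≢ v → Walk≤ G (suc d) ⌜ u ⌝ ⌜ v ⌝ →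
                  (∀ {w} → u ∼ w → w ≢ m → Farther d w v) → ¬ Visibleᶜ X u v
    blocked-byᶜ {u = u} {v} m d m∈X m≢v u≢v near far (visibleᶜ vis) =
      blocked-by G ⌜ m ⌝ d m∈X (m≢v ∘ ⌜⌝-injective) (u≢v ∘ ⌜⌝-injective) near
                 (λ {w} → via (view w)) vis
      where
      via : ∀ {w} → Coded w → adj G ⌜ u ⌝ w ≡ true → w ≢ ⌜ m ⌝ → ¬ Walk≤ G d w ⌜ v ⌝
      via (coded w) e w≢m = ¬walk≤ (far (adj⇒∼ᶜ e) (w≢m ∘ cong ⌜_⌝))

    leafᶜ : ∀ {k m} → (∀ {l} → k ∼ l → l ≡ m) → IsLeaf G ⌜ k ⌝
    leafᶜ {k} {m} only-m = ⌜ m ⌝ , λ {z} → via (view z)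
      where
      via : ∀ {z} → Coded z → adj G ⌜ k ⌝ z ≡ true → z ≡ ⌜ m ⌝
      via (coded l) e = cong ⌜_⌝ (only-m (adj⇒∼ᶜ e))

module Theta (n : ℕ) where
  open Subsets
  open Graphs
  open Presentations
  open import Data.Fin using (zero; suc; splitAt; _↑ˡ_; _↑ʳ_)
  open import Data.Fin.Properties using (splitAt-↑ˡ; splitAt-↑ʳ; splitAt⁻¹-↑ˡ; splitAt⁻¹-↑ʳ)
    renaming (_≟_ to _≟ᶠ_)
  open import Data.Fin.Subset using (Subset; _∈_; _∉_; ⊤; ⊥; ∣_∣; outside)
  open import Data.Fin.Subset.Properties using (_∈?_)
  open import Data.Nat using (_+_)
  open import Data.Nat.Properties using (≤-refl)
  open import Data.Product using (_,_)
  open import Data.Sum using (inj₁; inj₂)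
  open import Data.Vec using (_∷_; _++_; there)
  open import Function using (case_of_)
  open import Function.Bundles using (_↔_; mk↔ₛ′; Inverse)
  open import Relation.Nullary using (Dec; yes; no; map′; contradiction)
  open import Relation.Binary.PropositionalEquality using (_≡_; _≢_; refl; cong; trans)

  data SpiderVertex : Set where
    y     : SpiderVertex
    a b c : Fin n → SpiderVertex

  data _∼ˢ_ : SpiderVertex → SpiderVertex → Set where
    a∼b : ∀ {i} → a i ∼ˢ b i
    b∼a : ∀ {i} → b i ∼ˢ a i
    b∼c : ∀ {i} → b i ∼ˢ c i
    c∼b : ∀ {i} → c i ∼ˢ b i
    c∼y : ∀ {i} → c i ∼ˢ y
    y∼c : ∀ {i} → y ∼ˢ c i

  ∼ˢ-sym : ∀ {s t} → s ∼ˢ t → t ∼ˢ s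
  ∼ˢ-sym a∼b = b∼a
  ∼ˢ-sym b∼a = a∼b
  ∼ˢ-sym b∼c = c∼b
  ∼ˢ-sym c∼b = b∼c
  ∼ˢ-sym c∼y = y∼c
  ∼ˢ-sym y∼c = c∼y

  ∼ˢ-irrefl : ∀ {s} → ¬ s ∼ˢ s
  ∼ˢ-irrefl ()

  _∼ˢ?_ : ∀ s t → Dec (s ∼ˢ t)
  a i ∼ˢ? b j = map′ (λ { refl → a∼b }) (λ { a∼b → refl }) (i ≟ᶠ j)
  b i ∼ˢ? a j = map′ (λ { refl → b∼a }) (λ { b∼a → refl }) (i ≟ᶠ j)
  b i ∼ˢ? c j = map′ (λ { refl → b∼c }) (λ { b∼c → refl }) (i ≟ᶠ j)
  c i ∼ˢ? b j = map′ (λ { refl → c∼b }) (λ { c∼b → refl }) (i ≟ᶠ j)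
  c _ ∼ˢ? y   = yes c∼y
  y   ∼ˢ? c _ = yes y∼c
  y   ∼ˢ? y   = no λ ()
  y   ∼ˢ? a _ = no λ ()
  y   ∼ˢ? b _ = no λ ()
  a _ ∼ˢ? y   = no λ ()
  a _ ∼ˢ? a _ = no λ ()
  a _ ∼ˢ? c _ = no λ ()
  b _ ∼ˢ? y   = no λ ()
  b _ ∼ˢ? b _ = no λ ()
  c _ ∼ˢ? a _ = no λ ()
  c _ ∼ˢ? c _ = no λ ()

  data ThetaVertex : Set where
    x   : ThetaVertex
    ⌊_⌋ : SpiderVertex → ThetaVertex

  data _∼_ : ThetaVertex → ThetaVertex → Set where
    x∼a : ∀ {i} → x ∼ ⌊ a i ⌋
    a∼x : ∀ {i} → ⌊ a i ⌋ ∼ x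
    ⌊_⌋ : ∀ {s t} → s ∼ˢ t → ⌊ s ⌋ ∼ ⌊ t ⌋

  unwrap : ∀ {s t} → ⌊ s ⌋ ∼ ⌊ t ⌋ → s ∼ˢ t
  unwrap ⌊ s∼t ⌋ = s∼t

  ∼-sym : ∀ {u v} → u ∼ v → v ∼ u
  ∼-sym x∼a     = a∼x
  ∼-sym a∼x     = x∼a
  ∼-sym ⌊ s∼t ⌋ = ⌊ ∼ˢ-sym s∼t ⌋

  ∼-irrefl : ∀ {u} → ¬ u ∼ u
  ∼-irrefl ⌊ s∼s ⌋ = ∼ˢ-irrefl s∼s

  _∼?_ : ∀ u v → Dec (u ∼ v)
  x       ∼? x       = no λ ()
  x       ∼? ⌊ y ⌋   = no λ ()
  x       ∼? ⌊ a _ ⌋ = yes x∼a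
  x       ∼? ⌊ b _ ⌋ = no λ ()
  x       ∼? ⌊ c _ ⌋ = no λ ()
  ⌊ y ⌋   ∼? x       = no λ ()
  ⌊ a _ ⌋ ∼? x       = yes a∼x
  ⌊ b _ ⌋ ∼? x       = no λ ()
  ⌊ c _ ⌋ ∼? x       = no λ ()
  ⌊ s ⌋   ∼? ⌊ t ⌋   = map′ ⌊_⌋ unwrap (s ∼ˢ? t)

  Nˢ : ℕ
  Nˢ = suc (n + (n + n))

  spider-code : Fin Nˢ ↔ SpiderVertex
  spider-code = mk↔ₛ′ decode encode decode-encode encode-decode
    where
    decode : Fin Nˢ → SpiderVertex
    decode zero = y
    decode (suc u) with splitAt n u
    ... | inj₁ i = a i
    ... | inj₂ r with splitAt n r
    ...   | inj₁ i = b i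
    ...   | inj₂ i = c i

    encode : SpiderVertex → Fin Nˢ
    encode y     = zero
    encode (a i) = suc (i ↑ˡ (n + n))
    encode (b i) = suc (n ↑ʳ (i ↑ˡ n))
    encode (c i) = suc (n ↑ʳ (n ↑ʳ i))

    decode-encode : ∀ s → decode (encode s) ≡ s
    decode-encode y = refl
    decode-encode (a i) rewrite splitAt-↑ˡ n i (n + n) = refl
    decode-encode (b i) rewrite splitAt-↑ʳ n (n + n) (i ↑ˡ n) | splitAt-↑ˡ n i n = refl
    decode-encode (c i) rewrite splitAt-↑ʳ n (n + n) (n ↑ʳ i) | splitAt-↑ʳ n n i = refl

    encode-decode : ∀ u → encode (decode u) ≡ u
    encode-decode zero = refl
    encode-decode (suc u) with splitAt n u in eq
    ... | inj₁ i = cong suc (splitAt⁻¹-↑ˡ eq)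
    ... | inj₂ r with splitAt n r in eq′
    ...   | inj₁ i = cong suc (trans (cong (n ↑ʳ_) (splitAt⁻¹-↑ˡ eq′)) (splitAt⁻¹-↑ʳ eq))
    ...   | inj₂ i = cong suc (trans (cong (n ↑ʳ_) (splitAt⁻¹-↑ʳ eq′)) (splitAt⁻¹-↑ʳ eq))

  -- x is numbered 0, so that θ with x deleted is literally the spider on the remaining codes.
  θ-code : Fin (suc Nˢ) ↔ ThetaVertex
  θ-code = mk↔ₛ′ decode encode decode-encode encode-decode
    where
    open Inverse spider-code
    decode : Fin (suc Nˢ) → ThetaVertex
    decode zero    = x
    decode (suc u) = ⌊ to u ⌋

    encode : ThetaVertex → Fin (suc Nˢ)
    encode x     = zero
    encode ⌊ s ⌋ = suc (from s)

    decode-encode : ∀ v → decode (encode v) ≡ v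
    decode-encode x     = refl
    decode-encode ⌊ s ⌋ = cong ⌊_⌋ (strictlyInverseˡ s)

    encode-decode : ∀ u → encode (decode u) ≡ u
    encode-decode zero    = refl
    encode-decode (suc u) = cong suc (strictlyInverseʳ u)

  module θᴿ = FromRelation θ-code _∼?_ ∼-sym ∼-irrefl

  θ : Graph (suc Nˢ)
  θ = θᴿ.graph

  spider : Graph Nˢ
  spider = delete θ zero

  module Θ = Presented θ θ-code (λ {u} {w} → θᴿ.adj⇒∼ {u} {w}) (λ {k} {l} → θᴿ.∼⇒adj {k} {l})
  module S = Presented spider spider-code
               (λ {u} {w} e → unwrap (θᴿ.adj⇒∼ {suc u} {suc w} e))
               (λ {s} {t} s∼t → θᴿ.∼⇒adj {⌊ s ⌋} {⌊ t ⌋} ⌊ s∼t ⌋)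

  spider-to-y : ∀ u → Walk spider u S.⌜ y ⌝
  spider-to-y u = via (S.view u)
    where
    open S using (_◅_)
    via : ∀ {u} → S.Coded u → Walk spider u S.⌜ y ⌝
    via (S.coded y)     = stay
    via (S.coded (a i)) = a∼b ◅ b∼c ◅ c∼y ◅ stay
    via (S.coded (b i)) = b∼c ◅ c∼y ◅ stay
    via (S.coded (c i)) = c∼y ◅ stay

  spider-connected : Connected spider
  spider-connected = connected-via spider S.⌜ y ⌝ spider-to-y

  leaves : Subset Nˢ
  leaves = outside ∷ (⊤ {n} ++ ⊥ {n + n})

  ∣leaves∣ : ∣ leaves ∣ ≡ n
  ∣leaves∣ = ∣⊤++⊥∣ n (n + n)

  spider-leaves-totalMV : TotalMV spider leaves
  spider-leaves-totalMV = leaves-totalMV spider spider-connected leaves λ where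
    (there u∈) → case ∈⊤++⊥ n u∈ of λ where
      (i , refl) → S.leafᶜ {a i} {b i} λ { a∼b → refl }

  θ-connected : Fin n → Connected θ
  θ-connected i₀ = connected-via θ Θ.⌜ ⌊ y ⌋ ⌝ to-y
    where
    to-y : ∀ u → Walk θ u Θ.⌜ ⌊ y ⌋ ⌝
    to-y zero    = Θ._◅_ (x∼a {i₀}) (lift-walk {z = zero} (spider-to-y S.⌜ a i₀ ⌝))
    to-y (suc u) = lift-walk {z = zero} (spider-to-y u)

  _∈ᶿ_ : ThetaVertex → Subset (suc Nˢ) → Set
  v ∈ᶿ X = Θ.⌜ v ⌝ ∈ X

  _∉ᶿ_ : ThetaVertex → Subset (suc Nˢ) → Set
  v ∉ᶿ X = ¬ v ∈ᶿ X

  _∈ᶿ?_ : ∀ v X → Dec (v ∈ᶿ X)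
  v ∈ᶿ? X = Θ.⌜ v ⌝ ∈? X

  open Θ using (_◅_; Farther; Visibleᶜ; blocked-byᶜ) renaming (farther-zero to far₀; farther-suc to far)

  far-a-c : ∀ {i j} → i ≢ j → Farther 2 ⌊ a i ⌋ ⌊ c j ⌋
  far-a-c i≢j = far (λ ()) λ where
    a∼x     → far (λ ()) λ where
      x∼a → far₀ λ ()
    ⌊ a∼b ⌋ → far (λ ()) λ where
      ⌊ b∼a ⌋ → far₀ λ ()
      ⌊ b∼c ⌋ → far₀ λ { refl → i≢j refl }

  far-c-a : ∀ {i j} → i ≢ j → Farther 2 ⌊ c i ⌋ ⌊ a j ⌋
  far-c-a i≢j = far (λ ()) λ where
    ⌊ c∼b ⌋ → far (λ ()) λ where
      ⌊ b∼a ⌋ → far₀ λ { refl → i≢j refl }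
      ⌊ b∼c ⌋ → far₀ λ ()
    ⌊ c∼y ⌋ → far (λ ()) λ where
      ⌊ y∼c ⌋ → far₀ λ ()

  module _ {X : Subset (suc Nˢ)} {i : Fin n} where

    aᵢ-blocks-x-bᵢ : ⌊ a i ⌋ ∈ᶿ X → ¬ Visibleᶜ X x ⌊ b i ⌋
    aᵢ-blocks-x-bᵢ a∈ = blocked-byᶜ ⌊ a i ⌋ 1 a∈ (λ ()) (λ ())
      (x∼a ◅ ⌊ a∼b ⌋ ◅ stay , ≤-refl) λ where
        x∼a aⱼ≢aᵢ → far (λ ()) λ where
          a∼x     → far₀ λ ()
          ⌊ a∼b ⌋ → far₀ λ { refl → aⱼ≢aᵢ refl }

    aᵢ-blocks-x-cᵢ : ⌊ a i ⌋ ∈ᶿ X → ¬ Visibleᶜ X x ⌊ c i ⌋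
    aᵢ-blocks-x-cᵢ a∈ = blocked-byᶜ ⌊ a i ⌋ 2 a∈ (λ ()) (λ ())
      (x∼a ◅ ⌊ a∼b ⌋ ◅ ⌊ b∼c ⌋ ◅ stay , ≤-refl) λ where
        x∼a aⱼ≢aᵢ → far-a-c λ { refl → aⱼ≢aᵢ refl }

    bᵢ-blocks-aᵢ-cᵢ : ⌊ b i ⌋ ∈ᶿ X → ¬ Visibleᶜ X ⌊ a i ⌋ ⌊ c i ⌋
    bᵢ-blocks-aᵢ-cᵢ b∈ = blocked-byᶜ ⌊ b i ⌋ 1 b∈ (λ ()) (λ ())
      (⌊ a∼b ⌋ ◅ ⌊ b∼c ⌋ ◅ stay , ≤-refl) λ where
        a∼x     _   → far (λ ()) λ { x∼a → far₀ λ () }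
        ⌊ a∼b ⌋ b≢b → contradiction refl b≢b

    cᵢ-blocks-bᵢ-y : ⌊ c i ⌋ ∈ᶿ X → ¬ Visibleᶜ X ⌊ b i ⌋ ⌊ y ⌋
    cᵢ-blocks-bᵢ-y c∈ = blocked-byᶜ ⌊ c i ⌋ 1 c∈ (λ ()) (λ ())
      (⌊ b∼c ⌋ ◅ ⌊ c∼y ⌋ ◅ stay , ≤-refl) λ where
        ⌊ b∼a ⌋ _   → far (λ ()) λ where
          a∼x     → far₀ λ ()
          ⌊ a∼b ⌋ → far₀ λ ()
        ⌊ b∼c ⌋ c≢c → contradiction refl c≢c

    cᵢ-blocks-y-aᵢ : ⌊ c i ⌋ ∈ᶿ X → ¬ Visibleᶜ X ⌊ y ⌋ ⌊ a i ⌋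
    cᵢ-blocks-y-aᵢ c∈ = blocked-byᶜ ⌊ c i ⌋ 2 c∈ (λ ()) (λ ())
      (⌊ y∼c ⌋ ◅ ⌊ c∼b ⌋ ◅ ⌊ b∼a ⌋ ◅ stay , ≤-refl) λ where
        ⌊ y∼c ⌋ cⱼ≢cᵢ → far-c-a λ { refl → cⱼ≢cᵢ refl }

    module _ {j : Fin n} (i≢j : i ≢ j) where

      x-blocks-aᵢ-aⱼ : x ∈ᶿ X → ¬ Visibleᶜ X ⌊ a i ⌋ ⌊ a j ⌋
      x-blocks-aᵢ-aⱼ x∈ = blocked-byᶜ x 1 x∈ (λ ()) (λ { refl → i≢j refl })
        (a∼x ◅ x∼a ◅ stay , ≤-refl) λ where
          a∼x     x≢x → contradiction refl x≢x
          ⌊ a∼b ⌋ _   → far (λ ()) λ where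
            ⌊ b∼a ⌋ → far₀ λ { refl → i≢j refl }
            ⌊ b∼c ⌋ → far₀ λ ()

      y-blocks-cᵢ-cⱼ : ⌊ y ⌋ ∈ᶿ X → ¬ Visibleᶜ X ⌊ c i ⌋ ⌊ c j ⌋
      y-blocks-cᵢ-cⱼ y∈ = blocked-byᶜ ⌊ y ⌋ 1 y∈ (λ ()) (λ { refl → i≢j refl })
        (⌊ c∼y ⌋ ◅ ⌊ y∼c ⌋ ◅ stay , ≤-refl) λ where
          ⌊ c∼b ⌋ _   → far (λ ()) λ where
            ⌊ b∼a ⌋ → far₀ λ ()
            ⌊ b∼c ⌋ → far₀ λ { refl → i≢j refl }
          ⌊ c∼y ⌋ y≢y → contradiction refl y≢y

      aᵢ-blocks-bᵢ-aⱼ : ⌊ a i ⌋ ∈ᶿ X → ¬ Visibleᶜ X ⌊ b i ⌋ ⌊ a j ⌋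
      aᵢ-blocks-bᵢ-aⱼ a∈ = blocked-byᶜ ⌊ a i ⌋ 2 a∈ (λ { refl → i≢j refl }) (λ ())
        (⌊ b∼a ⌋ ◅ a∼x ◅ x∼a ◅ stay , ≤-refl) λ where
          ⌊ b∼a ⌋ a≢a → contradiction refl a≢a
          ⌊ b∼c ⌋ _   → far-c-a i≢j

      cᵢ-blocks-bᵢ-cⱼ : ⌊ c i ⌋ ∈ᶿ X → ¬ Visibleᶜ X ⌊ b i ⌋ ⌊ c j ⌋
      cᵢ-blocks-bᵢ-cⱼ c∈ = blocked-byᶜ ⌊ c i ⌋ 2 c∈ (λ { refl → i≢j refl }) (λ ())
        (⌊ b∼c ⌋ ◅ ⌊ c∼y ⌋ ◅ ⌊ y∼c ⌋ ◅ stay , ≤-refl) λ where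
          ⌊ b∼a ⌋ _   → far-a-c i≢j
          ⌊ b∼c ⌋ c≢c → contradiction refl c≢c

  module _ (other : Fin n → Fin n) (≢-other : ∀ i → i ≢ other i)
           {X : Subset (suc Nˢ)} (D : DualMV θ X) where

    both-in : ∀ {u v} → u ∈ᶿ X → v ∈ᶿ X → Visibleᶜ X u v
    both-in u∈ v∈ = Θ.visibleᶜ (D _ _ (inj₁ (u∈ , v∈)))

    both-out : ∀ {u v} → u ∉ᶿ X → v ∉ᶿ X → Visibleᶜ X u v
    both-out u∉ v∉ = Θ.visibleᶜ (D _ _ (inj₂ (u∉ , v∉)))

    a∉ : ∀ i → ⌊ a i ⌋ ∉ᶿ X
    a∉ i a∈ with x ∈ᶿ? X
    ... | yes x∈ = aᵢ-blocks-bᵢ-aⱼ (≢-other i) a∈ (both-out b∉ aⱼ∉)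
      where
      b∉ : ⌊ b i ⌋ ∉ᶿ X
      b∉ b∈ = aᵢ-blocks-x-bᵢ a∈ (both-in x∈ b∈)
      aⱼ∉ : ⌊ a (other i) ⌋ ∉ᶿ X
      aⱼ∉ aⱼ∈ = x-blocks-aᵢ-aⱼ (≢-other i) x∈ (both-in a∈ aⱼ∈)
    ... | no x∉ with ⌊ b i ⌋ ∈ᶿ? X
    ...   | yes b∈ = aᵢ-blocks-x-cᵢ a∈ (both-out x∉ λ c∈ → bᵢ-blocks-aᵢ-cᵢ b∈ (both-in a∈ c∈))
    ...   | no b∉  = aᵢ-blocks-x-bᵢ a∈ (both-out x∉ b∉)

    c∉ : ∀ i → ⌊ c i ⌋ ∉ᶿ X
    c∉ i c∈ with ⌊ y ⌋ ∈ᶿ? X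
    ... | yes y∈ = cᵢ-blocks-bᵢ-cⱼ (≢-other i) c∈ (both-out b∉ cⱼ∉)
      where
      b∉ : ⌊ b i ⌋ ∉ᶿ X
      b∉ b∈ = cᵢ-blocks-bᵢ-y c∈ (both-in b∈ y∈)
      cⱼ∉ : ⌊ c (other i) ⌋ ∉ᶿ X
      cⱼ∉ cⱼ∈ = y-blocks-cᵢ-cⱼ (≢-other i) y∈ (both-in c∈ cⱼ∈)
    ... | no y∉ = cᵢ-blocks-y-aᵢ c∈ (both-out y∉ (a∉ i))

    θ-dualMV-empty : Fin n → ∀ u → u ∉ X
    θ-dualMV-empty i₀ u = via (Θ.view u)
      where
      via : ∀ {u} → Θ.Coded u → u ∉ X
      via (Θ.coded x)       x∈ = x-blocks-aᵢ-aⱼ (≢-other i₀) x∈ (both-out (a∉ i₀) (a∉ (other i₀)))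
      via (Θ.coded ⌊ y ⌋)   y∈ = y-blocks-cᵢ-cⱼ (≢-other i₀) y∈ (both-out (c∉ i₀) (c∉ (other i₀)))
      via (Θ.coded ⌊ a i ⌋)    = a∉ i
      via (Θ.coded ⌊ b i ⌋) b∈ = bᵢ-blocks-aᵢ-cᵢ b∈ (both-out (a∉ i) (c∉ i))
      via (Θ.coded ⌊ c i ⌋)    = c∉ i

open Graphs
open import Data.Fin using (zero; suc)
open import Data.Integer using (+_; -[1+_]; ∣_∣; +<+; -<+)
import Data.Integer as ℤ
import Data.Integer.Properties as ℤ
import Data.Nat as ℕ
import Data.Nat.Properties as ℕ
open import Data.Nat.Coprimality using (1-coprimeTo) renaming (sym to coprime-sym)
open import Data.Product using (∃; _,_; proj₂)
open import Data.Rational using (ℚ; mkℚ; ↥_; 0ℚ; _+_; _*_; _/_; _<_; _≥_; *<*)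
open import Data.Rational.Properties using (normalize-coprime; <-≤-trans; <-irrefl; *-zeroʳ; +-identityˡ)
open import Relation.Nullary.Negation using (¬¬-map)
open import Relation.Binary.PropositionalEquality using (_≢_; refl; trans; cong; subst)
  renaming (sym to ≡-sym)

∣↥q∣<k⇒q<k/1 : ∀ q {k} → ∣ ↥ q ∣ ℕ.< k → q < (+ k) / 1
∣↥q∣<k⇒q<k/1 q@(mkℚ num d-1 _) {k} ∣num∣<k =
  subst (q <_) (≡-sym (normalize-coprime (coprime-sym (1-coprimeTo k))))
    (*<* (subst (ℤ._< _) (≡-sym (ℤ.*-identityʳ num))
                (subst (num ℤ.<_) (ℤ.pos-* k (suc d-1)) (below num ∣num∣<k))))
  where
  below : ∀ i → ∣ i ∣ ℕ.< k → i ℤ.< + (k ℕ.* suc d-1)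
  below (+ j)     j<k = +<+ (ℕ.<-≤-trans j<k (ℕ.m≤m*n k (suc d-1)))
  below -[1+ j ] _    = -<+

record DeletionGap (IsMu : ∀ {m} → Graph m → ℕ → Set) (k : ℕ) : Set where
  field
    {order}          : ℕ
    graph            : Graph (suc order)
    vertex           : Fin (suc order)
    connected        : Connected graph
    connected-delete : Connected (delete graph vertex)
    μ≡0              : IsMu graph 0
    μ-delete≥        : ¬ ¬ ∃ λ k′ → k ℕ.≤ k′ × IsMu (delete graph vertex) k′

no-affine-bound : (IsMu : ∀ {m} → Graph m → ℕ → Set) → (∀ k → DeletionGap IsMu k) →
  ¬ Σ ℚ λ a → Σ ℚ λ b → 0ℚ < a ×
      (∀ (m : ℕ) (G : Graph (suc m)) (x : Fin (suc m)) →
        Connected G → Connected (delete G x) →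
        ∀ (k k′ : ℕ) → IsMu G k → IsMu (delete G x) k′ →
        a * ((+ k) / 1) + b ≥ (+ k′) / 1)
no-affine-bound IsMu gap (a , b , _ , bound) = μ-delete≥ λ (k′ , k≤k′ , μ′) →
  <-irrefl refl (<-≤-trans (∣↥q∣<k⇒q<k/1 b (ℕ.<-≤-trans (ℕ.n<1+n _) k≤k′))
    (subst (_≥ (+ k′) / 1) (trans (cong (_+ b) (*-zeroʳ a)) (+-identityˡ b))
      (bound _ graph vertex connected connected-delete 0 k′ μ≡0 μ′)))
  where open DeletionGap (gap (suc ∣ ↥ b ∣))

module _ (k : ℕ) where
  open Theta (suc (suc k))

  other : Fin (suc (suc k)) → Fin (suc (suc k))
  other zero    = suc zero
  other (suc _) = zero

  ≢-other : ∀ i → i ≢ other i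
  ≢-other zero    ()
  ≢-other (suc _) ()

  leaves-lower-bound : ∀ {P} → P leaves → ¬ ¬ ∃ λ k′ → k ℕ.≤ k′ × IsMaxCard spider P k′
  leaves-lower-bound P-leaves =
    ¬¬-map (λ (k′ , max) → k′ , ℕ.≤-trans (ℕ.m≤n+m k 2)
                                           (subst (ℕ._≤ k′) ∣leaves∣ (proj₂ max leaves P-leaves)) , max)
           (¬¬-maxCard spider leaves P-leaves)

  θ-dual-gap : DeletionGap IsMuD k
  θ-dual-gap = record
    { graph            = θ
    ; vertex           = zero
    ; connected        = θ-connected zero
    ; connected-delete = spider-connected
    ; μ≡0              = maxCard-zero θ (totalMV⇒dualMV θ (∅-totalMV θ (θ-connected zero)))
                                        λ _ D → θ-dualMV-empty other ≢-other D zero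
    ; μ-delete≥        = leaves-lower-bound (totalMV⇒dualMV spider spider-leaves-totalMV)
    }

  θ-total-gap : DeletionGap IsMuT k
  θ-total-gap = record
    { graph            = θ
    ; vertex           = zero
    ; connected        = θ-connected zero
    ; connected-delete = spider-connected
    ; μ≡0              = maxCard-zero θ (∅-totalMV θ (θ-connected zero))
                                        λ _ T → θ-dualMV-empty other ≢-other (totalMV⇒dualMV θ T) zero
    ; μ-delete≥        = leaves-lower-bound spider-leaves-totalMV
    }

corollary5p4 : (¬ Σ ℚ λ a → Σ ℚ λ b → 0ℚ < a ×
    (∀ (m : ℕ) (G : Graph (suc m)) (x : Fin (suc m)) →
      Connected G → Connected (delete G x) →
      ∀ (k k′ : ℕ) → IsMuD G k → IsMuD (delete G x) k′ →
      a * ((+ k) / 1) + b ≥ (+ k′) / 1))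
  ×
  (¬ Σ ℚ λ a → Σ ℚ λ b → 0ℚ < a ×
    (∀ (m : ℕ) (G : Graph (suc m)) (x : Fin (suc m)) →
      Connected G → Connected (delete G x) →
      ∀ (k k′ : ℕ) → IsMuT G k → IsMuT (delete G x) k′ →
      a * ((+ k) / 1) + b ≥ (+ k′) / 1))
corollary5p4 = no-affine-bound IsMuD θ-dual-gap , no-affine-bound IsMuT θ-total-gap
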